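{- Suppose that $\Gamma^{\mathrm{sym}}(\mathbb{F}_2^n)$ is a monoidal network for every $n>1$. Then for every $n\geq 1$, every extended submonoid $M\subseteq\mathbb{F}_2^n$ has a pseudocomplement.
   Context: Rings are commutative with identity; $\mathrm{Aut}(R)$ is the ring automorphism group and $R^{\mathrm{Aut}(R)}$ the subring fixed by all automorphisms. For a group $G$ acting on a set $X$ and $S\subseteq X$, $G^S$ is the setwise stabilizer. The symmetric multiaction $\Gamma^{\mathrm{sym}}(R)$ assigns to each ideal $I$ of $R$ the group $\Gamma_I=\mathrm{Sym}(R/I)$ acting naturally on $R/I$ (so $\Gamma_0=\mathrm{Sym}(R)$). An extended submonoid of $R$ is a multiplicatively closed subset $M\subseteq R$ with $1\in M$ and $R^{\mathrm{Aut}(R)}\subseteq M$. An ideal $I$ with projection $\pi:R\to R/I$ is a covering ideal of $M$ if there is an extended submonoid $\hat M\subseteq M$ with $M\setminus\hat M\subseteq I$ such that for every $g\in\Gamma_I^{\pi(\hat M)}$ there is $\tilde g\in\Gamma_0^{\hat M}$ with $\pi(\tilde g(x))=g(\pi(x))$ for all $x\in\hat M$. The multiaction is a monoidal network if every extended submonoid has a proper, nonzero covering ideal. For an extended submonoid $M\subseteq\mathbb{F}_2^n$ and an involution $T:M\to M$, the quadratic ideal $\Lambda(T)$ is the ideal of $\mathbb{F}_2^n$ generated by $\{xT(x):x\in M\}$; $T$ is a pseudocomplement if $\Lambda(T)$ is proper. -}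

module Defs where

open import Data.Nat using (ℕ)
open import Data.Bool using (Bool; true; false; _xor_; _∧_)
open import Data.Vec using (Vec; zipWith; replicate)
open import Data.Product using (Σ; ∃; _×_; proj₁; proj₂)
open import Relation.Binary.PropositionalEquality using (_≡_; _≢_)
open import Relation.Nullary using (¬_)

R : ℕ → Set
R n = Vec Bool n

_⊕_ : ∀ {n} → R n → R n → R n
_⊕_ = zipWith _xor_

_⊗_ : ∀ {n} → R n → R n → R n
_⊗_ = zipWith _∧_

infixl 6 _⊕_
infixl 7 _⊗_

𝟘 : ∀ {n} → R n
𝟘 = replicate _ false

𝟙 : ∀ {n} → R n
𝟙 = replicate _ true

Sub : ℕ → Set
Sub n = R n → Bool

_∈_ : ∀ {n} → R n → Sub n → Set
x ∈ S = S x ≡ true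

_⊆_ : ∀ {n} → Sub n → Sub n → Set
A ⊆ B = ∀ x → x ∈ A → x ∈ B

record Aut (n : ℕ) : Set where
  field
    f    : R n → R n
    finv : R n → R n
    left  : ∀ x → finv (f x) ≡ x
    right : ∀ x → f (finv x) ≡ x
    pres-⊕ : ∀ x y → f (x ⊕ y) ≡ f x ⊕ f y
    pres-⊗ : ∀ x y → f (x ⊗ y) ≡ f x ⊗ f y
    pres-𝟙 : f 𝟙 ≡ 𝟙

FixedByAut : ∀ {n} → R n → Set
FixedByAut {n} x = (σ : Aut n) → Aut.f σ x ≡ x

record ExtendedSubmonoid {n : ℕ} (M : Sub n) : Set where
  field
    has-𝟙   : 𝟙 ∈ M
    closed-⊗ : ∀ x y → x ∈ M → y ∈ M → (x ⊗ y) ∈ M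
    has-fixed : ∀ x → FixedByAut x → x ∈ M

record Ideal {n : ℕ} (I : Sub n) : Set where
  field
    has-𝟘    : 𝟘 ∈ I
    closed-⊕ : ∀ x y → x ∈ I → y ∈ I → (x ⊕ y) ∈ I
    absorb   : ∀ r x → x ∈ I → (r ⊗ x) ∈ I

Proper : ∀ {n} → Sub n → Set
Proper I = ¬ (𝟙 ∈ I)

Nonzero : ∀ {n} → Sub n → Set
Nonzero I = ∃ λ x → x ∈ I × x ≢ 𝟘

-- Congruence modulo I: π(x) = π(y) in R/I.
_~[_]_ : ∀ {n} → R n → Sub n → R n → Set
x ~[ I ] y = (x ⊕ y) ∈ I

-- Γ_I = Sym(R/I): permutations of R/I, represented on representatives.

record SymQ {n : ℕ} (I : Sub n) : Set where
  field
    g    : R n → R n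
    ginv : R n → R n
    g-resp    : ∀ x y → x ~[ I ] y → g x ~[ I ] g y
    ginv-resp : ∀ x y → x ~[ I ] y → ginv x ~[ I ] ginv y
    left  : ∀ x → ginv (g x) ~[ I ] x
    right : ∀ x → g (ginv x) ~[ I ] x

StabQ : ∀ {n} (I : Sub n) → SymQ I → Sub n → Set
StabQ I γ S =
  (∀ x → x ∈ S → ∃ λ y → y ∈ S × (SymQ.g γ x ~[ I ] y)) ×
  (∀ y → y ∈ S → ∃ λ x → x ∈ S × (SymQ.g γ x ~[ I ] y))

record Perm (n : ℕ) : Set where
  field
    p    : R n → R n
    pinv : R n → R n
    left  : ∀ x → pinv (p x) ≡ x
    right : ∀ x → p (pinv x) ≡ x

StabPerm : ∀ {n} → Perm n → Sub n → Set
StabPerm γ S =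
  (∀ x → x ∈ S → ∃ λ y → y ∈ S × (Perm.p γ x ≡ y)) ×
  (∀ y → y ∈ S → ∃ λ x → x ∈ S × (Perm.p γ x ≡ y))

CoveringIdeal : ∀ {n} → Sub n → Sub n → Set
CoveringIdeal {n} I M =
  Σ (Sub n) λ M̂ →
    ExtendedSubmonoid M̂ × M̂ ⊆ M ×
    (∀ x → x ∈ M → ¬ (x ∈ M̂) → x ∈ I) ×
    ((γ : SymQ I) → StabQ I γ M̂ →
       Σ (Perm n) λ γ̃ → StabPerm γ̃ M̂ ×
         (∀ x → x ∈ M̂ → Perm.p γ̃ x ~[ I ] SymQ.g γ x))

MonoidalNetwork : ℕ → Set
MonoidalNetwork n =
  (M : Sub n) → ExtendedSubmonoid M →
    Σ (Sub n) λ I → Ideal I × Proper I × Nonzero I × CoveringIdeal I M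

Elt : ∀ {n} → Sub n → Set
Elt {n} M = Σ (R n) λ x → x ∈ M

data Λ {n : ℕ} {M : Sub n} (T : Elt M → Elt M) : R n → Set where
  gen  : (c : Elt M) → Λ T (proj₁ c ⊗ proj₁ (T c))
  zero : Λ T 𝟘
  add  : ∀ {x y} → Λ T x → Λ T y → Λ T (x ⊕ y)
  mul  : ∀ r {x} → Λ T x → Λ T (r ⊗ x)

IsInvolution : ∀ {n} {M : Sub n} → (Elt M → Elt M) → Set
IsInvolution T = ∀ c → proj₁ (T (T c)) ≡ proj₁ c

HasPseudocomplement : ∀ {n} → Sub n → Set
HasPseudocomplement M =
  Σ (Elt M → Elt M) λ T → IsInvolution T × ¬ (Λ T 𝟙)

module Submission where

-- Call an involution t of F₂ⁿ *separating* for M if it maps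
-- M into itself and, for some coordinate i, no x ∈ M has x_i = t(x)_i = 1.
-- Then every generator x·t(x) of Λ(t) vanishes at i, so Λ(t) lies in the
-- maximal ideal {z : z_i = 0} and t is a pseudocomplement.  We show by strong
-- induction on n ≥ 1 that every extended submonoid M ⊆ F₂ⁿ has a separating
-- involution.  For n = 1, M = F₂ and complementation works.  For n > 1 the
-- monoidal-network hypothesis provides a proper nonzero covering ideal I with
-- submonoid M̂.  Ideals of F₂ⁿ are coordinate ideals, so R/I ≅ F₂ᵏ, 1 ≤ k < n,
-- via a coordinate projection π; the image π(M̂) is an extended submonoid of
-- F₂ᵏ (as R^{Aut(R)} = {0,1}), so by induction it has a separating involution
-- h.  Viewed in Sym(R/I), h stabilises π(M̂) and therefore lifts to a
-- permutation p of F₂ⁿ stabilising M̂; pairing each x ∈ M̂ with p(x) or p⁻¹(x)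
-- along the separating coordinate gives a separating involution of M.

open import Defs
open import Data.Nat using (ℕ; zero; suc; _<_; _≤_; z≤n; s≤s)
open import Data.Nat.Properties using (m≤n⇒m≤1+n)
open import Data.Nat.Induction using (<-rec)
open import Data.Bool using (Bool; true; false; not; _xor_; _∧_)
open import Data.Bool.Properties using (∧-zeroʳ; ∧-inverseʳ; not-involutive; xor-same; xor-identityʳ)
import Data.Bool.Properties as Bool
open import Data.Fin using (Fin; zero; suc)
open import Data.Vec using (Vec; []; _∷_; lookup; tabulate; replicate)
open import Data.Vec.Properties
  using (∷-injectiveˡ; ∷-injectiveʳ; lookup-zipWith; lookup-replicate; lookup∘tabulate; ≡-dec)
open import Data.Product using (Σ; ∃; _×_; _,_; proj₁)
open import Data.Empty using (⊥-elim)
open import Data.Sum as Sum using (_⊎_; inj₁; inj₂)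
open import Relation.Nullary using (¬_; Dec; yes; no; does)
open import Relation.Nullary.Decidable using (dec-true; map′; _×-dec_; _⊎-dec_)
open import Relation.Binary.PropositionalEquality
  using (_≡_; _≢_; refl; sym; trans; cong; cong₂; subst; module ≡-Reasoning)

open ≡-Reasoning

true≢false : true ≢ false
true≢false ()

⊕-self : ∀ {n} (x : R n) → x ⊕ x ≡ 𝟘
⊕-self []       = refl
⊕-self (b ∷ xs) = cong₂ _∷_ (xor-same b) (⊕-self xs)

⊕-identityˡ : ∀ {n} (x : R n) → 𝟘 ⊕ x ≡ x
⊕-identityˡ []       = refl
⊕-identityˡ (b ∷ xs) = cong (b ∷_) (⊕-identityˡ xs)

⊗-zeroˡ : ∀ {n} (x : R n) → 𝟘 ⊗ x ≡ 𝟘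
⊗-zeroˡ []       = refl
⊗-zeroˡ (b ∷ xs) = cong (false ∷_) (⊗-zeroˡ xs)

⊕≡𝟘⇒≡ : ∀ {n} (x y : R n) → x ⊕ y ≡ 𝟘 → x ≡ y
⊕≡𝟘⇒≡ []       []       _  = refl
⊕≡𝟘⇒≡ (a ∷ xs) (b ∷ ys) eq =
  cong₂ _∷_ (xor≡false⇒≡ a b (∷-injectiveˡ eq)) (⊕≡𝟘⇒≡ xs ys (∷-injectiveʳ eq))
  where
  xor≡false⇒≡ : ∀ a b → a xor b ≡ false → a ≡ b
  xor≡false⇒≡ false false _ = refl
  xor≡false⇒≡ true  true  _ = refl
  xor≡false⇒≡ false true  ()
  xor≡false⇒≡ true  false ()

-- F₂ⁿ is finite, so existence of an element with a decidable property is
-- decidable; this makes images of subsets computable (Bool-valued).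
∃? : ∀ n {P : R n → Set} → (∀ x → Dec (P x)) → Dec (∃ P)
∃? zero    {P} P? = map′ ([] ,_) (λ { ([] , p) → p }) (P? [])
∃? (suc n) {P} P? =
  map′ join split (∃? n (λ xs → P? (false ∷ xs)) ⊎-dec ∃? n (λ xs → P? (true ∷ xs)))
  where
  join : ∃ (λ xs → P (false ∷ xs)) ⊎ ∃ (λ xs → P (true ∷ xs)) → ∃ P
  join (inj₁ (xs , p)) = false ∷ xs , p
  join (inj₂ (xs , p)) = true ∷ xs , p
  split : ∃ P → ∃ (λ xs → P (false ∷ xs)) ⊎ ∃ (λ xs → P (true ∷ xs))
  split (false ∷ xs , p) = inj₁ (xs , p)
  split (true ∷ xs , p)  = inj₂ (xs , p)

record SeparatingInvolution {n : ℕ} (M : Sub n) : Set where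
  field
    t          : R n → R n
    involutive : ∀ x → t (t x) ≡ x
    preserves  : ∀ x → x ∈ M → t x ∈ M
    coordinate : Fin n
    separates  : ∀ x → x ∈ M → lookup x coordinate ∧ lookup (t x) coordinate ≡ false

-- Evaluation at coordinate i is a ring map, so if it kills all generators
-- x·T(x) of Λ(T) it kills the whole ideal Λ(T).
Λ-vanishes : ∀ {n} {M : Sub n} (T : Elt M → Elt M) (i : Fin n) →
  (∀ c → lookup (proj₁ c ⊗ proj₁ (T c)) i ≡ false) →
  ∀ {z} → Λ T z → lookup z i ≡ false
Λ-vanishes T i gens (gen c) = gens c
Λ-vanishes T i gens zero    = lookup-replicate i false
Λ-vanishes T i gens (add {x} {y} l₁ l₂) = begin
  lookup (x ⊕ y) i            ≡⟨ lookup-zipWith _xor_ i x y ⟩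
  lookup x i xor lookup y i   ≡⟨ cong₂ _xor_ (Λ-vanishes T i gens l₁) (Λ-vanishes T i gens l₂) ⟩
  false                       ∎
Λ-vanishes T i gens (mul r {x} l) = begin
  lookup (r ⊗ x) i            ≡⟨ lookup-zipWith _∧_ i r x ⟩
  lookup r i ∧ lookup x i     ≡⟨ cong (lookup r i ∧_) (Λ-vanishes T i gens l) ⟩
  lookup r i ∧ false          ≡⟨ ∧-zeroʳ (lookup r i) ⟩
  false                       ∎

-- A separating involution restricts to a pseudocomplement: Λ(t) misses 1
-- because 1 does not vanish at the separating coordinate.
separating⇒pseudocomplement : ∀ {n} {M : Sub n} →
  SeparatingInvolution M → HasPseudocomplement M
separating⇒pseudocomplement {M = M} σ = T , (λ c → involutive (proj₁ c)) , 𝟙∉Λ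
  where
  open SeparatingInvolution σ
  T : Elt M → Elt M
  T (x , x∈M) = t x , preserves x x∈M
  generators-vanish : ∀ c → lookup (proj₁ c ⊗ proj₁ (T c)) coordinate ≡ false
  generators-vanish (x , x∈M) = trans (lookup-zipWith _∧_ coordinate x (t x)) (separates x x∈M)
  𝟙∉Λ : ¬ Λ T 𝟙
  𝟙∉Λ l = true≢false (trans (sym (lookup-replicate coordinate true))
                              (Λ-vanishes T coordinate generators-vanish l))

-- Additive maps fix 0 = 0 + 0.
𝟘-fixed : ∀ {n} → FixedByAut {n} 𝟘
𝟘-fixed σ = begin
  f 𝟘           ≡⟨ cong f (sym (⊕-self 𝟘)) ⟩
  f (𝟘 ⊕ 𝟘)     ≡⟨ pres-⊕ 𝟘 𝟘 ⟩
  f 𝟘 ⊕ f 𝟘     ≡⟨ ⊕-self (f 𝟘) ⟩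
  𝟘             ∎
  where open Aut σ

tailAut : ∀ {k} → Aut k → Aut (suc k)
tailAut {k} σ = record
  { f      = λ { (b ∷ xs) → b ∷ f xs }
  ; finv   = λ { (b ∷ xs) → b ∷ finv xs }
  ; left   = λ { (b ∷ xs) → cong (b ∷_) (left xs) }
  ; right  = λ { (b ∷ xs) → cong (b ∷_) (right xs) }
  ; pres-⊕ = λ { (a ∷ xs) (b ∷ ys) → cong ((a xor b) ∷_) (pres-⊕ xs ys) }
  ; pres-⊗ = λ { (a ∷ xs) (b ∷ ys) → cong ((a ∧ b) ∷_) (pres-⊗ xs ys) }
  ; pres-𝟙 = cong (true ∷_) pres-𝟙
  }
  where open Aut σ

swapAut : ∀ {k} → Aut (suc (suc k))
swapAut = record
  { f      = swap
  ; finv   = swap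
  ; left   = λ { (a ∷ b ∷ xs) → refl }
  ; right  = λ { (a ∷ b ∷ xs) → refl }
  ; pres-⊕ = λ { (a ∷ b ∷ xs) (c ∷ d ∷ ys) → refl }
  ; pres-⊗ = λ { (a ∷ b ∷ xs) (c ∷ d ∷ ys) → refl }
  ; pres-𝟙 = refl
  }
  where
  swap : ∀ {k} → R (suc (suc k)) → R (suc (suc k))
  swap (a ∷ b ∷ xs) = b ∷ a ∷ xs

-- (F₂ᵏ)^{Aut} = {0, 1}: coordinate permutations are automorphisms, so a fixed
-- vector has all coordinates equal.
fixed⇒trivial : ∀ k (y : R k) → FixedByAut y → y ≡ 𝟘 ⊎ y ≡ 𝟙
fixed⇒trivial zero          []           _  = inj₁ refl
fixed⇒trivial (suc zero)    (false ∷ []) _  = inj₁ refl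
fixed⇒trivial (suc zero)    (true ∷ [])  _  = inj₂ refl
fixed⇒trivial (suc (suc k)) (a ∷ b ∷ ys) fx =
  Sum.map prepend prepend (fixed⇒trivial (suc k) (b ∷ ys) tail-fixed)
  where
  a≡b : a ≡ b
  a≡b = sym (∷-injectiveˡ (fx swapAut))
  tail-fixed : FixedByAut (b ∷ ys)
  tail-fixed σ = ∷-injectiveʳ (fx (tailAut σ))
  prepend : ∀ {c} → b ∷ ys ≡ replicate (suc k) c → a ∷ b ∷ ys ≡ replicate (suc (suc k)) c
  prepend eq = cong₂ _∷_ (trans a≡b (∷-injectiveˡ eq)) eq

dim : ∀ {n} → Vec Bool n → ℕ
dim []          = 0
dim (true ∷ J)  = suc (dim J)
dim (false ∷ J) = dim J

proj : ∀ {n} (J : Vec Bool n) → R n → R (dim J)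
proj []          []       = []
proj (true ∷ J)  (x ∷ xs) = x ∷ proj J xs
proj (false ∷ J) (x ∷ xs) = proj J xs

sec : ∀ {n} (J : Vec Bool n) → R (dim J) → R n
sec []          []       = []
sec (true ∷ J)  (y ∷ ys) = y ∷ sec J ys
sec (false ∷ J) ys       = false ∷ sec J ys

emb : ∀ {n} (J : Vec Bool n) → Fin (dim J) → Fin n
emb (true ∷ J)  zero    = zero
emb (true ∷ J)  (suc j) = suc (emb J j)
emb (false ∷ J) j       = suc (emb J j)

proj-sec : ∀ {n} (J : Vec Bool n) y → proj J (sec J y) ≡ y
proj-sec []          []       = refl
proj-sec (true ∷ J)  (y ∷ ys) = cong (y ∷_) (proj-sec J ys)
proj-sec (false ∷ J) ys       = proj-sec J ys

proj-lookup : ∀ {n} (J : Vec Bool n) x j → lookup (proj J x) j ≡ lookup x (emb J j)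
proj-lookup (true ∷ J)  (x ∷ xs) zero    = refl
proj-lookup (true ∷ J)  (x ∷ xs) (suc j) = proj-lookup J xs j
proj-lookup (false ∷ J) (x ∷ xs) j       = proj-lookup J xs j

proj-⊕ : ∀ {n} (J : Vec Bool n) x y → proj J (x ⊕ y) ≡ proj J x ⊕ proj J y
proj-⊕ []          []       []       = refl
proj-⊕ (true ∷ J)  (x ∷ xs) (y ∷ ys) = cong ((x xor y) ∷_) (proj-⊕ J xs ys)
proj-⊕ (false ∷ J) (x ∷ xs) (y ∷ ys) = proj-⊕ J xs ys

proj-⊗ : ∀ {n} (J : Vec Bool n) x y → proj J (x ⊗ y) ≡ proj J x ⊗ proj J y
proj-⊗ []          []       []       = refl
proj-⊗ (true ∷ J)  (x ∷ xs) (y ∷ ys) = cong ((x ∧ y) ∷_) (proj-⊗ J xs ys)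
proj-⊗ (false ∷ J) (x ∷ xs) (y ∷ ys) = proj-⊗ J xs ys

proj-const : ∀ {n} (J : Vec Bool n) b → proj J (replicate n b) ≡ replicate (dim J) b
proj-const []          b = refl
proj-const (true ∷ J)  b = cong (b ∷_) (proj-const J b)
proj-const (false ∷ J) b = proj-const J b

vanishes⇒proj≡𝟘 : ∀ {n} (J : Vec Bool n) z →
  (∀ i → lookup J i ≡ true → lookup z i ≡ false) → proj J z ≡ 𝟘
vanishes⇒proj≡𝟘 []          []       _ = refl
vanishes⇒proj≡𝟘 (true ∷ J)  (x ∷ xs) h =
  cong₂ _∷_ (h zero refl) (vanishes⇒proj≡𝟘 J xs (λ i → h (suc i)))
vanishes⇒proj≡𝟘 (false ∷ J) (x ∷ xs) h = vanishes⇒proj≡𝟘 J xs (λ i → h (suc i))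

proj≡𝟘⇒vanishes : ∀ {n} (J : Vec Bool n) z → proj J z ≡ 𝟘 →
  ∀ i → lookup J i ≡ true → lookup z i ≡ false
proj≡𝟘⇒vanishes (true ∷ J)  (x ∷ xs) eq zero    _ = ∷-injectiveˡ eq
proj≡𝟘⇒vanishes (true ∷ J)  (x ∷ xs) eq (suc i) s = proj≡𝟘⇒vanishes J xs (∷-injectiveʳ eq) i s
proj≡𝟘⇒vanishes (false ∷ J) (x ∷ xs) eq (suc i) s = proj≡𝟘⇒vanishes J xs eq i s

dim≤ : ∀ {n} (J : Vec Bool n) → dim J ≤ n
dim≤ []          = z≤n
dim≤ (true ∷ J)  = s≤s (dim≤ J)
dim≤ (false ∷ J) = m≤n⇒m≤1+n (dim≤ J)

dim-positive : ∀ {n} (J : Vec Bool n) x → proj J x ≢ 𝟘 → 1 ≤ dim J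
dim-positive []          []       ne = ⊥-elim (ne refl)
dim-positive (true ∷ J)  _        _  = s≤s z≤n
dim-positive (false ∷ J) (x ∷ xs) ne = dim-positive J xs ne

dim-< : ∀ {n} (J : Vec Bool n) z → proj J z ≡ 𝟘 → z ≢ 𝟘 → dim J < n
dim-< []          []       _  ne = ⊥-elim (ne refl)
dim-< (true ∷ J)  (x ∷ xs) eq ne =
  s≤s (dim-< J xs (∷-injectiveʳ eq) (λ xs≡𝟘 → ne (cong₂ _∷_ (∷-injectiveˡ eq) xs≡𝟘)))
dim-< (false ∷ J) (x ∷ xs) _  _  = s≤s (dim≤ J)

module _ {n : ℕ} (J : Vec Bool n) where

  image? : ∀ S y → Dec (∃ λ x → x ∈ S × proj J x ≡ y)
  image? S y = ∃? n (λ x → (S x Bool.≟ true) ×-dec ≡-dec Bool._≟_ (proj J x) y)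

  image : Sub n → Sub (dim J)
  image S y = does (image? S y)

  image-intro : ∀ {S} x → x ∈ S → proj J x ∈ image S
  image-intro {S} x x∈S = dec-true (image? S (proj J x)) (x , x∈S , refl)

  image-elim : ∀ {S} y → y ∈ image S → ∃ λ x → x ∈ S × proj J x ≡ y
  image-elim {S} y y∈π[S] with image? S y
  ... | yes witness = witness
  image-elim {S} y () | no _

  -- π is a surjective ring map and (F₂^{dim J})^{Aut} = {0, 1}, so the image
  -- of an extended submonoid is again an extended submonoid.
  image-extended : ∀ {S} → ExtendedSubmonoid S → ExtendedSubmonoid (image S)
  image-extended {S} ext = record
    { has-𝟙     = subst (_∈ image S) (proj-const J true) (image-intro 𝟙 has-𝟙)
    ; closed-⊗  = λ x y x∈ y∈ → closed (image-elim x x∈) (image-elim y y∈)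
    ; has-fixed = λ y fixed → trivial∈ (fixed⇒trivial (dim J) y fixed)
    }
    where
    open ExtendedSubmonoid ext
    closed : ∀ {x y} → (∃ λ x′ → x′ ∈ S × proj J x′ ≡ x) →
             (∃ λ y′ → y′ ∈ S × proj J y′ ≡ y) → (x ⊗ y) ∈ image S
    closed (x′ , x′∈S , refl) (y′ , y′∈S , refl) =
      subst (_∈ image S) (proj-⊗ J x′ y′) (image-intro _ (closed-⊗ x′ y′ x′∈S y′∈S))
    const∈ : ∀ b → replicate n b ∈ S → replicate (dim J) b ∈ image S
    const∈ b c∈S = subst (_∈ image S) (proj-const J b) (image-intro _ c∈S)
    trivial∈ : ∀ {y} → y ≡ 𝟘 ⊎ y ≡ 𝟙 → y ∈ image S
    trivial∈ (inj₁ refl) = const∈ false (has-fixed 𝟘 𝟘-fixed)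
    trivial∈ (inj₂ refl) = const∈ true has-𝟙

unit : ∀ {n} → Fin n → R n
unit zero    = true ∷ 𝟘
unit (suc i) = false ∷ unit i

-- eᵢ · z = eᵢ whenever z_i = 1; hence an ideal containing z contains eᵢ.
unit-⊗ : ∀ {n} (i : Fin n) z → lookup z i ≡ true → unit i ⊗ z ≡ unit i
unit-⊗ zero    (b ∷ zs) refl = cong (true ∷_) (⊗-zeroˡ zs)
unit-⊗ (suc i) (b ∷ zs) zᵢ   = cong (false ∷_) (unit-⊗ i zs zᵢ)

-- z is the sum of the unit vectors on its support; so any property closed
-- under 0 and + that holds for those unit vectors holds for z.
support-induction : ∀ {n} (P : R n → Set) → P 𝟘 → (∀ x y → P x → P y → P (x ⊕ y)) →
  ∀ z → (∀ i → lookup z i ≡ true → P (unit i)) → P z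
support-induction {zero}  P P𝟘 P⊕ []       _ = P𝟘
support-induction {suc n} P P𝟘 P⊕ (b ∷ zs) P-units =
  subst P (cong₂ _∷_ (xor-identityʳ b) (⊕-identityˡ zs)) (P⊕ _ _ (head b (P-units zero)) tail)
  where
  head : ∀ c → (c ≡ true → P (unit zero)) → P (c ∷ 𝟘)
  head true  P-e₀ = P-e₀ refl
  head false _    = P𝟘
  tail : P (false ∷ zs)
  tail = support-induction (λ y → P (false ∷ y)) P𝟘 (λ x y → P⊕ (false ∷ x) (false ∷ y))
           zs (λ i → P-units (suc i))

module CoordinateIdeal {n : ℕ} {I : Sub n} (ideal : Ideal I) where
  open Ideal ideal

  -- The coordinates whose unit vector lies outside I; R/I ≅ F₂ᵏ by projecting
  -- onto them.
  J : Vec Bool n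
  J = tabulate (λ i → not (I (unit i)))

  k : ℕ
  k = dim J

  π : R n → R k
  π = proj J

  ∈I⇒π≡𝟘 : ∀ z → z ∈ I → π z ≡ 𝟘
  ∈I⇒π≡𝟘 z z∈I = vanishes⇒proj≡𝟘 J z vanishes
    where
    vanishes : ∀ i → lookup J i ≡ true → lookup z i ≡ false
    vanishes i selected with lookup z i in zᵢ
    ... | false = refl
    ... | true  = ⊥-elim (true≢false (begin
      true                  ≡⟨ sym selected ⟩
      lookup J i            ≡⟨ lookup∘tabulate _ i ⟩
      not (I (unit i))      ≡⟨ cong not (subst (_∈ I) (unit-⊗ i z zᵢ) (absorb (unit i) z z∈I)) ⟩
      false                 ∎))

  π≡𝟘⇒∈I : ∀ z → π z ≡ 𝟘 → z ∈ I
  π≡𝟘⇒∈I z πz≡𝟘 = support-induction (_∈ I) has-𝟘 closed-⊕ z unit∈I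
    where
    unit∈I : ∀ i → lookup z i ≡ true → unit i ∈ I
    unit∈I i zᵢ with I (unit i) in eᵢ∈I
    ... | true  = refl
    ... | false = ⊥-elim (true≢false (trans (sym zᵢ)
      (proj≡𝟘⇒vanishes J z πz≡𝟘 i (trans (lookup∘tabulate _ i) (cong not eᵢ∈I)))))

  ~⇒π≡ : ∀ x y → x ~[ I ] y → π x ≡ π y
  ~⇒π≡ x y x~y = ⊕≡𝟘⇒≡ _ _ (trans (sym (proj-⊕ J x y)) (∈I⇒π≡𝟘 _ x~y))

  π≡⇒~ : ∀ x y → π x ≡ π y → x ~[ I ] y
  π≡⇒~ x y πx≡πy = π≡𝟘⇒∈I _ (begin
    π (x ⊕ y)     ≡⟨ proj-⊕ J x y ⟩
    π x ⊕ π y     ≡⟨ cong (_⊕ π y) πx≡πy ⟩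
    π y ⊕ π y     ≡⟨ ⊕-self (π y) ⟩
    𝟘             ∎)

  -- An involution h of F₂ᵏ ≅ R/I, acting on representatives through the
  -- section of π, is a permutation of R/I (its own inverse).
  quotientPerm : (h : R k → R k) → (∀ y → h (h y) ≡ y) → SymQ I
  quotientPerm h h-inv = record
    { g         = g
    ; ginv      = g
    ; g-resp    = g-resp
    ; ginv-resp = g-resp
    ; left      = g-inv
    ; right     = g-inv
    }
    where
    g : R n → R n
    g x = sec J (h (π x))
    g-resp : ∀ x y → x ~[ I ] y → g x ~[ I ] g y
    g-resp x y x~y = π≡⇒~ _ _ (cong (λ w → π (sec J (h w))) (~⇒π≡ x y x~y))
    g-inv : ∀ x → g (g x) ~[ I ] x
    g-inv x = π≡⇒~ _ _ (begin
      π (g (g x))       ≡⟨ proj-sec J _ ⟩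
      h (π (g x))       ≡⟨ cong h (proj-sec J _) ⟩
      h (h (π x))       ≡⟨ h-inv (π x) ⟩
      π x               ∎)

  quotientPerm-stabilises : ∀ (h : R k → R k) (h-inv : ∀ y → h (h y) ≡ y) S →
    (∀ x → x ∈ S → ∃ λ y → y ∈ S × π y ≡ h (π x)) → StabQ I (quotientPerm h h-inv) S
  quotientPerm-stabilises h h-inv S h-maps = forward , backward
    where
    g = SymQ.g (quotientPerm h h-inv)
    π-g : ∀ x → π (g x) ≡ h (π x)
    π-g x = proj-sec J (h (π x))
    forward : ∀ x → x ∈ S → ∃ λ y → y ∈ S × (g x ~[ I ] y)
    forward x x∈S with h-maps x x∈S
    ... | y , y∈S , πy≡hπx = y , y∈S , π≡⇒~ _ _ (trans (π-g x) (sym πy≡hπx))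
    backward : ∀ y → y ∈ S → ∃ λ x → x ∈ S × (g x ~[ I ] y)
    backward y y∈S with h-maps y y∈S
    ... | x , x∈S , πx≡hπy = x , x∈S , π≡⇒~ _ _ (begin
      π (g x)        ≡⟨ π-g x ⟩
      h (π x)        ≡⟨ cong h πx≡hπy ⟩
      h (h (π y))    ≡⟨ h-inv (π y) ⟩
      π y            ∎)

-- Pairing
-- x ∈ S with p(x) when x_i = 1, with p⁻¹(x) when p⁻¹(x)_i = 1, and fixing all
-- other points gives a separating involution of M.
module PermutationMatching {n : ℕ} {M S : Sub n} (S⊆M : S ⊆ M) (i : Fin n) (σ : Perm n)
  (p-closed    : ∀ x → x ∈ S → Perm.p σ x ∈ S)
  (pinv-closed : ∀ x → x ∈ S → Perm.pinv σ x ∈ S)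
  (outside     : ∀ x → x ∈ M → ¬ (x ∈ S) → lookup x i ≡ false)
  (drops       : ∀ x → x ∈ S → lookup x i ≡ true → lookup (Perm.p σ x) i ≡ false)
  where
  open Perm σ

  -- t is kept opaque: the four lemmas below are its whole specification.
  opaque
    choose : Bool → Bool → Bool → R n → R n
    choose true true  _    x = p x
    choose true false true x = pinv x
    choose _    _     _    x = x

    t : R n → R n
    t x = choose (S x) (lookup x i) (lookup (pinv x) i) x

    t-forward : ∀ x → x ∈ S → lookup x i ≡ true → t x ≡ p x
    t-forward x x∈S xᵢ rewrite x∈S | xᵢ = refl

    t-backward : ∀ x → x ∈ S → lookup x i ≡ false → lookup (pinv x) i ≡ true → t x ≡ pinv x
    t-backward x x∈S xᵢ yᵢ rewrite x∈S | xᵢ | yᵢ = refl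

    t-idle : ∀ x → x ∈ S → lookup x i ≡ false → lookup (pinv x) i ≡ false → t x ≡ x
    t-idle x x∈S xᵢ yᵢ rewrite x∈S | xᵢ | yᵢ = refl

    t-outside : ∀ x → S x ≡ false → t x ≡ x
    t-outside x x∉S rewrite x∉S = refl

  involutive : ∀ x → t (t x) ≡ x
  involutive x with S x in x∈S | lookup x i in xᵢ | lookup (pinv x) i in yᵢ
  ... | true | true | _ = begin
    t (t x)          ≡⟨ cong t (t-forward x x∈S xᵢ) ⟩
    t (p x)          ≡⟨ t-backward (p x) (p-closed x x∈S) (drops x x∈S xᵢ)
                          (trans (cong (λ w → lookup w i) (left x)) xᵢ) ⟩
    pinv (p x)       ≡⟨ left x ⟩
    x                ∎
  ... | true | false | true = begin
    t (t x)          ≡⟨ cong t (t-backward x x∈S xᵢ yᵢ) ⟩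
    t (pinv x)       ≡⟨ t-forward (pinv x) (pinv-closed x x∈S) yᵢ ⟩
    p (pinv x)       ≡⟨ right x ⟩
    x                ∎
  ... | true | false | false = trans (cong t (t-idle x x∈S xᵢ yᵢ)) (t-idle x x∈S xᵢ yᵢ)
  ... | false | _ | _ = trans (cong t (t-outside x x∈S)) (t-outside x x∈S)

  stays-in-S : ∀ x → x ∈ S → t x ∈ S
  stays-in-S x x∈S with lookup x i in xᵢ | lookup (pinv x) i in yᵢ
  ... | true  | _     = subst (_∈ S) (sym (t-forward x x∈S xᵢ)) (p-closed x x∈S)
  ... | false | true  = subst (_∈ S) (sym (t-backward x x∈S xᵢ yᵢ)) (pinv-closed x x∈S)
  ... | false | false = subst (_∈ S) (sym (t-idle x x∈S xᵢ yᵢ)) x∈S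

  preserves : ∀ x → x ∈ M → t x ∈ M
  preserves x x∈M with S x in x∈S
  ... | true  = S⊆M _ (stays-in-S x x∈S)
  ... | false = subst (_∈ M) (sym (t-outside x x∈S)) x∈M

  separates : ∀ x → x ∈ M → lookup x i ∧ lookup (t x) i ≡ false
  separates x x∈M with lookup x i in xᵢ
  ... | false = refl
  ... | true with S x in x∈S
  ...   | true  = trans (cong (λ w → lookup w i) (t-forward x x∈S xᵢ)) (drops x x∈S xᵢ)
  ...   | false = ⊥-elim (true≢false (trans (sym xᵢ)
                    (outside x x∈M (λ x∈S′ → true≢false (trans (sym x∈S′) x∈S)))))

  separatingInvolution : SeparatingInvolution M
  separatingInvolution = record
    { t = t ; involutive = involutive ; preserves = preserves
    ; coordinate = i ; separates = separates }

module Lift {n : ℕ} {M I M̂ : Sub n} (ideal : Ideal I) (M̂⊆M : M̂ ⊆ M)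
  (outside : ∀ x → x ∈ M → ¬ (x ∈ M̂) → x ∈ I)
  (lifts : (γ : SymQ I) → StabQ I γ M̂ →
     Σ (Perm n) λ γ̃ → StabPerm γ̃ M̂ × (∀ x → x ∈ M̂ → Perm.p γ̃ x ~[ I ] SymQ.g γ x))
  where
  open CoordinateIdeal ideal

  separation : SeparatingInvolution (image J M̂) → SeparatingInvolution M
  separation τ = matching (lifts γ (quotientPerm-stabilises h h-inv M̂ h-maps))
    where
    open SeparatingInvolution τ
      renaming (t to h; involutive to h-inv; preserves to h-preserves;
                coordinate to j; separates to h-separates)

    γ : SymQ I
    γ = quotientPerm h h-inv

    h-maps : ∀ x → x ∈ M̂ → ∃ λ y → y ∈ M̂ × π y ≡ h (π x)
    h-maps x x∈M̂ = image-elim J (h (π x)) (h-preserves (π x) (image-intro J x x∈M̂))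

    i : Fin n
    i = emb J j

    bitᵢ : ∀ x → lookup x i ≡ lookup (π x) j
    bitᵢ x = sym (proj-lookup J x j)

    -- M ∖ M̂ ⊆ I, and I vanishes on the selected coordinates.
    vanishes : ∀ x → x ∈ M → ¬ (x ∈ M̂) → lookup x i ≡ false
    vanishes x x∈M x∉M̂ = begin
      lookup x i       ≡⟨ bitᵢ x ⟩
      lookup (π x) j   ≡⟨ cong (λ w → lookup w j) (∈I⇒π≡𝟘 x (outside x x∈M x∉M̂)) ⟩
      lookup 𝟘 j       ≡⟨ lookup-replicate j false ⟩
      false            ∎

    matching : Σ (Perm n) (λ σ → StabPerm σ M̂ × (∀ x → x ∈ M̂ → Perm.p σ x ~[ I ] SymQ.g γ x)) →
               SeparatingInvolution M
    matching (σ , (into , onto) , covers) =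
      PermutationMatching.separatingInvolution M̂⊆M i σ p-closed pinv-closed vanishes drops
      where
      open Perm σ

      p-closed : ∀ x → x ∈ M̂ → p x ∈ M̂
      p-closed x x∈M̂ with into x x∈M̂
      ... | y , y∈M̂ , px≡y = subst (_∈ M̂) (sym px≡y) y∈M̂

      pinv-closed : ∀ y → y ∈ M̂ → pinv y ∈ M̂
      pinv-closed y y∈M̂ with onto y y∈M̂
      ... | x , x∈M̂ , px≡y = subst (_∈ M̂) (trans (sym (left x)) (cong pinv px≡y)) x∈M̂

      π-p : ∀ x → x ∈ M̂ → π (p x) ≡ h (π x)
      π-p x x∈M̂ = trans (~⇒π≡ _ _ (covers x x∈M̂)) (proj-sec J (h (π x)))

      -- h separates π(M̂) at j, so p turns a 1 at i on M̂ into a 0.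
      drops : ∀ x → x ∈ M̂ → lookup x i ≡ true → lookup (p x) i ≡ false
      drops x x∈M̂ xᵢ = begin
        lookup (p x) i                       ≡⟨ bitᵢ (p x) ⟩
        lookup (π (p x)) j                   ≡⟨ cong (λ w → lookup w j) (π-p x x∈M̂) ⟩
        lookup (h (π x)) j                   ≡⟨ cong (_∧ lookup (h (π x)) j) (trans (sym xᵢ) (bitᵢ x)) ⟩
        lookup (π x) j ∧ lookup (h (π x)) j  ≡⟨ h-separates (π x) (image-intro J x x∈M̂) ⟩
        false                                ∎

-- Over F₂ an extended submonoid contains 0 and 1, i.e. everything, and
-- complementation separates it at the only coordinate.
base : (M : Sub 1) → ExtendedSubmonoid M → SeparatingInvolution M
base M ext = record
  { t          = complement
  ; involutive = λ { (b ∷ []) → cong (_∷ []) (not-involutive b) }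
  ; preserves  = λ x _ → everything (complement x)
  ; coordinate = zero
  ; separates  = λ { (b ∷ []) _ → ∧-inverseʳ b }
  }
  where
  open ExtendedSubmonoid ext
  complement : R 1 → R 1
  complement (b ∷ []) = not b ∷ []
  everything : ∀ x → x ∈ M
  everything (false ∷ []) = has-fixed 𝟘 𝟘-fixed
  everything (true ∷ [])  = has-𝟙

-- Strong induction on n: the covering ideal reduces F₂ⁿ to F₂ᵏ with 1 ≤ k < n.
separating : ((n : ℕ) → 1 < n → MonoidalNetwork n) →
  ∀ n → 1 ≤ n → (M : Sub n) → ExtendedSubmonoid M → SeparatingInvolution M
separating network = <-rec Claim step
  where
  Claim : ℕ → Set
  Claim n = 1 ≤ n → (M : Sub n) → ExtendedSubmonoid M → SeparatingInvolution M

  step : ∀ n → (∀ {m} → m < n → Claim m) → Claim n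
  step zero          _  ()
  step (suc zero)    _  _ = base
  step (suc (suc m)) ih _ M ext
    with network (suc (suc m)) (s≤s (s≤s z≤n)) M ext
  ... | I , ideal , proper , (z , z∈I , z≢𝟘) , M̂ , M̂-ext , M̂⊆M , outside , lifts =
    Lift.separation ideal M̂⊆M outside lifts
      (ih k<n k≥1 (image J M̂) (image-extended J M̂-ext))
    where
    open CoordinateIdeal ideal
    k≥1 : 1 ≤ k
    k≥1 = dim-positive J 𝟙 (λ π𝟙≡𝟘 → proper (π≡𝟘⇒∈I 𝟙 π𝟙≡𝟘))
    k<n : k < suc (suc m)
    k<n = dim-< J z (∈I⇒π≡𝟘 z z∈I) z≢𝟘

proposition4 : ((n : ℕ) → 1 < n → MonoidalNetwork n) →
    (n : ℕ) → 1 ≤ n → (M : Sub n) → ExtendedSubmonoid M → HasPseudocomplement M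
proposition4 network n n≥1 M ext =
  separating⇒pseudocomplement (separating network n n≥1 M ext)
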